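{- For $F\in\mathbb{N}$, let $\mathrm{nF}(F)$ denote the number of reflective numerical semigroups $S$ with Frobenius number $F(S)=F$. Then \[ \mathrm{nF}(F)=1-\tau_e(F)+\sum_{k=2}^{F}(-1)^k\left\lfloor \frac{F}{k}\right\rfloor, \] where $\tau_e(F)$ denotes the number of even positive divisors of $F$.
   Context: A numerical semigroup is a submonoid $S$ of $(\mathbb{N}_0,+)$ with finite complement; its genus is $g(S)=\#(\mathbb{N}_0\setminus S)$ and, when $g(S)\ge1$, its Frobenius number $F(S)$ is the largest element of $\mathbb{N}_0\setminus S$. A numerical semigroup $S$ of genus $g\ge1$ is reflective if for every integer $z$ with $0\le z\le g-1$, exactly one of $z$ and $z+g$ lies in $S$. -}

module Defs where

open import Data.Bool using (Bool; true; false; not; _xor_)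
open import Data.Nat using (ℕ; zero; suc; _+_; _≤_; _<_; _/_)
open import Data.Nat.Divisibility using (_∣_; _∣?_)
open import Data.Integer using (ℤ; +_; -_; _-_; _^_) renaming (_+_ to _+ℤ_; _*_ to _*ℤ_)
open import Data.List using (List; length; filter; map; upTo)
open import Data.Fin using (Fin)
open import Data.Product using (Σ; _×_)
open import Relation.Nullary.Decidable using (_×-dec_)
open import Relation.Binary.PropositionalEquality using (_≡_)

Subset : Set
Subset = ℕ → Bool

IsNumericalSemigroup : Subset → Set
IsNumericalSemigroup S =
  (S 0 ≡ true)
  × (∀ a b → S a ≡ true → S b ≡ true → S (a + b) ≡ true)
  × Σ ℕ (λ N → ∀ n → N ≤ n → S n ≡ true)

gapsBelow : Subset → ℕ → ℕ
gapsBelow S zero = 0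
gapsBelow S (suc n) with S n
... | true  = gapsBelow S n
... | false = suc (gapsBelow S n)

HasGenus : Subset → ℕ → Set
HasGenus S g = Σ ℕ (λ N → (∀ n → N ≤ n → S n ≡ true) × (gapsBelow S N ≡ g))

HasFrobenius : Subset → ℕ → Set
HasFrobenius S F = (S F ≡ false) × (∀ n → F < n → S n ≡ true)

IsReflective : Subset → Set
IsReflective S = Σ ℕ (λ g → HasGenus S g × (1 ≤ g)
                         × (∀ z → z < g → (S z xor S (z + g)) ≡ true))

ReflectiveWithFrobenius : ℕ → Subset → Set
ReflectiveWithFrobenius F S = IsNumericalSemigroup S × IsReflective S × HasFrobenius S F

-- "the subsets satisfying P (up to extensional equality) number exactly N":
-- an enumeration by Fin N, injective and surjective up to pointwise equality.
HasCount : (Subset → Set) → ℕ → Set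
HasCount P N =
  Σ (Fin N → Subset) (λ e →
      (∀ i → P (e i))
    × (∀ i j → (∀ n → e i n ≡ e j n) → i ≡ j)
    × (∀ S → P S → Σ (Fin N) (λ i → ∀ n → e i n ≡ S n)))

τe : ℕ → ℕ
τe F = length (filter (λ d → (2 ∣? d) ×-dec (d ∣? F)) (map suc (upTo F)))

altSum : ℕ → ℕ → ℤ
altSum F zero = + 0
altSum F (suc zero) = + 0
altSum F (suc (suc j)) = altSum F (suc j) +ℤ ((- + 1) ^ (suc (suc j))) *ℤ (+ (F / suc (suc j)))

nF-formula : ℕ → ℤ
nF-formula F = (+ 1 - + τe F) +ℤ altSum F F

{-# OPTIONS --safe #-}
module Submission where

-- A reflective numerical semigroup S of genus g is determined by g and its multiplicity m:
-- below g it consists of the multiples of m, on [g, 2g) it is the complement of the shift of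
-- S ∩ [0, g) by g, and it contains everything from 2g on (there are already g gaps below 2g).
-- Writing k m < g < (k + 1) m, its Frobenius number is g + k m, so the reflective semigroups with
-- Frobenius number F correspond to the pairs (k, m) with 2 k m < F < (2 k + 1) m.  For k = 0 only
-- m = F + 1 qualifies; for k ≥ 1 the number of such m is ⌊F/2k⌋ − [2k ∣ F] − ⌊F/(2k+1)⌋, and
-- summing over k gives the formula.

open import Data.Bool using (Bool; true; false; not; _∧_; _∨_; _xor_; if_then_else_)
open import Data.Bool.Properties using (¬-not; not-injective; xor-inverseʳ)
open import Data.Empty using (⊥-elim)
open import Data.Fin using (zero; suc)
open import Data.Integer using (ℤ; +_; -_; 1ℤ; -1ℤ)
  renaming (_+_ to _+ℤ_; _-_ to _-ℤ_; _*_ to _*ℤ_; _^_ to _^ℤ_)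
import Data.Integer.Properties as ℤ
open import Data.Integer.Tactic.RingSolver using (solve-∀)
open import Data.List using (List; []; _∷_; [_]; _++_; length; filter; map; lookup; upTo; downFrom; cartesianProduct)
open import Data.List.Properties using (length-++; filter-++; upTo-∷ʳ)
open import Data.List.Membership.Propositional using (_∈_)
open import Data.List.Membership.Propositional.Properties
  using (∈-lookup; ∈-filter⁺; ∈-filter⁻; ∈-cartesianProduct⁺; ∈-cartesianProduct⁻; ∈-downFrom⁺; ∈-downFrom⁻)
import Data.List.Relation.Unary.All as All
open import Data.List.Relation.Unary.AllPairs using (_∷_)
open import Data.List.Relation.Unary.Any using (index)
open import Data.List.Relation.Unary.Any.Properties using (lookup-index)
open import Data.List.Relation.Unary.Unique.Propositional using (Unique)
open import Data.List.Relation.Unary.Unique.Propositional.Properties using (filter⁺; cartesianProduct⁺; downFrom⁺)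
open import Data.Nat
open import Data.Nat.Properties
open import Algebra.Properties.CommutativeSemigroup +-commutativeSemigroup
  using (interchange; x∙yz≈y∙xz; xy∙z≈xz∙y)
open import Data.Nat.DivMod
open import Data.Nat.Divisibility
open import Data.Product using (Σ; _×_; _,_; proj₁; proj₂)
open import Data.Sum using (_⊎_; inj₁; inj₂; [_,_]′)
open import Function using (_⇔_; mk⇔)
open import Relation.Nullary using (Dec; yes; no; ¬_; does)
open import Relation.Nullary.Decidable using (_×-dec_; _⊎-dec_; dec-true; dec-false; does-⇔)
open import Relation.Unary using (Decidable)
open import Relation.Binary.PropositionalEquality hiding ([_])
open import Defs

-- Counting on initial segments of ℕ

bit : Bool → ℕ
bit b = if b then 1 else 0

count : (ℕ → Bool) → ℕ → ℕ
count p zero    = 0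
count p (suc n) = bit (p n) + count p n

module _ {p : ℕ → Bool} where

  count-cong : ∀ {q} n → (∀ i → i < n → p i ≡ q i) → count p n ≡ count q n
  count-cong zero    p≗q = refl
  count-cong (suc n) p≗q =
    cong₂ _+_ (cong bit (p≗q n ≤-refl)) (count-cong n (λ i i<n → p≗q i (m<n⇒m<1+n i<n)))

  count-false : ∀ n → (∀ i → i < n → p i ≡ false) → count p n ≡ 0
  count-false zero    _   = refl
  count-false (suc n) p≡f rewrite p≡f n ≤-refl = count-false n (λ i i<n → p≡f i (m<n⇒m<1+n i<n))

  count-true : ∀ n → (∀ i → i < n → p i ≡ true) → count p n ≡ n
  count-true zero    _   = refl
  count-true (suc n) p≡t rewrite p≡t n ≤-refl = cong suc (count-true n (λ i i<n → p≡t i (m<n⇒m<1+n i<n)))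

  count-+ : ∀ m n → count p (m + n) ≡ count p m + count (λ i → p (m + i)) n
  count-+ m zero    = trans (cong (count p) (+-identityʳ m)) (sym (+-identityʳ _))
  count-+ m (suc n) rewrite +-suc m n | count-+ m n =
    x∙yz≈y∙xz (bit (p (m + n))) (count p m) (count (λ i → p (m + i)) n)

  count-split : ∀ {m n} → m ≤ n → count p n ≡ count p m + count (λ i → p (m + i)) (n ∸ m)
  count-split {m} m≤n = trans (cong (count p) (sym (m+[n∸m]≡n m≤n))) (count-+ m _)

  count-mono : ∀ {m n} → m ≤ n → count p m ≤ count p n
  count-mono {m} m≤n = subst (count p m ≤_) (sym (count-split m≤n)) (m≤m+n (count p m) _)

  count-∨ : ∀ {q} n → (∀ i → i < n → p i ∧ q i ≡ false) →
            count p n + count q n ≡ count (λ i → p i ∨ q i) n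
  count-∨ zero _ = refl
  count-∨ {q} (suc n) disjoint =
    trans (interchange (bit (p n)) (count p n) (bit (q n)) (count q n))
          (cong₂ _+_ (bit-∨ (p n) (q n) (disjoint n ≤-refl))
                     (count-∨ n (λ i i<n → disjoint i (m<n⇒m<1+n i<n))))
    where
      bit-∨ : ∀ a b → a ∧ b ≡ false → bit a + bit b ≡ bit (a ∨ b)
      bit-∨ true  false _ = refl
      bit-∨ false _     _ = refl

count-⊎ : ∀ {A B C : ℕ → Set} (A? : Decidable A) (B? : Decidable B) (C? : Decidable C) n →
          (∀ i → A i → ¬ B i) → (∀ i → (A i ⊎ B i) ⇔ C i) →
          count (λ i → does (A? i)) n + count (λ i → does (B? i)) n ≡ count (λ i → does (C? i)) n
count-⊎ A? B? C? n disjoint A⊎B⇔C =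
  trans (count-∨ n (λ i _ → dec-false (A? i ×-dec B? i) (λ (a , b) → disjoint i a b)))
        (count-cong n (λ i _ → does-⇔ (A⊎B⇔C i) (A? i ⊎-dec B? i) (C? i)))

count-≤ : ∀ {q n} → q < n → count (λ i → does (i ≤? q)) n ≡ suc q
count-≤ {q} {n} q<n = begin
  count p n                                                  ≡⟨ count-split q<n ⟩
  count p (suc q) + count (λ i → p (suc q + i)) (n ∸ suc q)  ≡⟨ cong₂ _+_ below above ⟩
  suc q + 0                                                  ≡⟨ +-identityʳ (suc q) ⟩
  suc q                                                      ∎
  where
    open ≡-Reasoning
    p = λ i → does (i ≤? q)
    below = count-true (suc q) (λ i i<1+q → dec-true (i ≤? q) (≤-pred i<1+q))
    above = count-false (n ∸ suc q) (λ i _ → dec-false (suc q + i ≤? q) (<⇒≱ (s≤s (m≤m+n q i))))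

count-≟ : ∀ {q n} → q < n → count (λ i → does (i ≟ q)) n ≡ 1
count-≟ {q} {n} q<n = begin
  count p n                                                        ≡⟨ count-split q<n ⟩
  bit (p q) + count p q + count (λ i → p (suc q + i)) (n ∸ suc q)  ≡⟨ cong₂ _+_ (cong₂ _+_ at-q below) above ⟩
  1                                                                ∎
  where
    open ≡-Reasoning
    p = λ i → does (i ≟ q)
    at-q  = cong bit (dec-true (q ≟ q) refl)
    below = count-false q (λ i i<q → dec-false (i ≟ q) (<⇒≢ i<q))
    above = count-false (n ∸ suc q) (λ i _ → dec-false (suc q + i ≟ q) (λ eq → <⇒≢ (s≤s (m≤m+n q i)) (sym eq)))

module _ {A B : Set} {P : B → Set} (P? : Decidable P) where

  length-filter-map : ∀ (f : A → B) xs → length (filter P? (map f xs)) ≡ length (filter (λ x → P? (f x)) xs)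
  length-filter-map f []       = refl
  length-filter-map f (x ∷ xs) with does (P? (f x))
  ... | true  = cong suc (length-filter-map f xs)
  ... | false = length-filter-map f xs

module _ {P : ℕ → Set} (P? : Decidable P) where

  length-filter-downFrom : ∀ n → length (filter P? (downFrom n)) ≡ count (λ i → does (P? i)) n
  length-filter-downFrom zero    = refl
  length-filter-downFrom (suc n) with does (P? n)
  ... | true  = cong suc (length-filter-downFrom n)
  ... | false = length-filter-downFrom n

  length-filter-upTo : ∀ n → length (filter P? (upTo n)) ≡ count (λ i → does (P? i)) n
  length-filter-upTo zero    = refl
  length-filter-upTo (suc n) = begin
    length (filter P? (upTo (suc n)))                       ≡⟨ cong (λ xs → length (filter P? xs)) (upTo-∷ʳ n) ⟨
    length (filter P? (upTo n ++ [ n ]))                    ≡⟨ cong length (filter-++ P? (upTo n) [ n ]) ⟩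
    length (filter P? (upTo n) ++ filter P? [ n ])          ≡⟨ length-++ (filter P? (upTo n)) ⟩
    length (filter P? (upTo n)) + length (filter P? [ n ])  ≡⟨ cong₂ _+_ (length-filter-upTo n) singleton ⟩
    count (λ i → does (P? i)) n + bit (does (P? n))         ≡⟨ +-comm (count (λ i → does (P? i)) n) _ ⟩
    count (λ i → does (P? i)) (suc n)                       ∎
    where
      open ≡-Reasoning
      singleton : length (filter P? [ n ]) ≡ bit (does (P? n))
      singleton with does (P? n)
      ... | true  = refl
      ... | false = refl

lookup-injective : ∀ {A : Set} {xs : List A} → Unique xs → ∀ i j → lookup xs i ≡ lookup xs j → i ≡ j
lookup-injective (_  ∷ _) zero    zero    _  = refl
lookup-injective (x≢ ∷ _) zero    (suc j) eq = ⊥-elim (All.lookup x≢ (∈-lookup j) eq)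
lookup-injective (x≢ ∷ _) (suc i) zero    eq = ⊥-elim (All.lookup x≢ (∈-lookup i) (sym eq))
lookup-injective (_  ∷ u) (suc i) (suc j) eq = cong suc (lookup-injective u i j eq)

hasCount-fromList : ∀ {A : Set} {P : Subset → Set} (decode : A → Subset) (xs : List A) → Unique xs →
  (∀ {x} → x ∈ xs → P (decode x)) →
  (∀ {x y} → x ∈ xs → y ∈ xs → (∀ n → decode x n ≡ decode y n) → x ≡ y) →
  (∀ S → P S → Σ A λ x → x ∈ xs × (∀ n → decode x n ≡ S n)) →
  HasCount P (length xs)
hasCount-fromList decode xs unique sound injective complete =
  (λ i → decode (lookup xs i)) ,
  (λ i → sound (∈-lookup i)) ,
  (λ i j eq → lookup-injective unique i j (injective (∈-lookup i) (∈-lookup j) eq)) ,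
  λ S PS → let x , x∈xs , decode≗S = complete S PS in
    index x∈xs , λ n → trans (cong (λ y → decode y n) (sym (lookup-index x∈xs))) (decode≗S n)

-- Multiples and quotients

m*n≤o⇔n≤o/m : ∀ {m n o} .{{_ : NonZero m}} → m * n ≤ o ⇔ n ≤ o / m
m*n≤o⇔n≤o/m {m} {n} {o} = mk⇔
  (λ le → subst (_≤ o / m) (m*n/n≡m n m) (/-monoˡ-≤ m (subst (_≤ o) (*-comm m n) le)))
  (λ le → ≤-trans (subst (_≤ o / m * m) (*-comm n m) (*-monoˡ-≤ m le)) (m/n*n≤m o m))

∣∧<⇒≡0 : ∀ {m n} → m ∣ n → n < m → n ≡ 0
∣∧<⇒≡0 {n = zero}  _   _   = refl
∣∧<⇒≡0 {n = suc n} m∣n n<m = ⊥-elim (>⇒∤ n<m m∣n)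

BetweenMultiples : ℕ → ℕ → ℕ → Set
BetweenMultiples k m n = k * m < n × n < suc k * m

between? : ∀ k m n → Dec (BetweenMultiples k m n)
between? k m n = (k * m <? n) ×-dec (n <? suc k * m)

between⇒∤ : ∀ {k m n} → BetweenMultiples k m n → ¬ m ∣ n
between⇒∤ {k} {m} (lo , hi) (divides q refl) =
  <⇒≱ (*-cancelʳ-< m k q lo) (≤-pred (*-cancelʳ-< m q (suc k) hi))

∤⇒between : ∀ {m n} .{{_ : NonZero m}} → ¬ m ∣ n → BetweenMultiples (n / m) m n
∤⇒between {m} {n} m∤n =
  ≤∧≢⇒< (m/n*n≤m n m) (λ eq → m∤n (divides (n / m) (sym eq))) ,
  subst (_< m + n / m * m) (sym (m≡m%n+[m/n]*n n m)) (+-monoˡ-< (n / m * m) (m%n<n n m))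

between-unique : ∀ {k k′ m n} → BetweenMultiples k m n → BetweenMultiples k′ m n → k ≡ k′
between-unique {m = m} b b′ = ≤-antisym (≮⇒≥ (disjoint b′ b)) (≮⇒≥ (disjoint b b′))
  where
    disjoint : ∀ {k k′ n} → BetweenMultiples k m n → BetweenMultiples k′ m n → ¬ k < k′
    disjoint (_ , hi) (lo′ , _) k<k′ = <-irrefl refl (<-trans (<-≤-trans hi (*-monoˡ-≤ m k<k′)) lo′)

module _ (j F : ℕ) .{{_ : NonZero j}} where

  count-multiples-≤ : ∀ {n} → F < n → count (λ m → does (j * m ≤? F)) n ≡ suc (F / j)
  count-multiples-≤ {n} F<n =
    trans (count-cong n (λ m _ → does-⇔ m*n≤o⇔n≤o/m (j * m ≤? F) (m ≤? F / j)))
          (count-≤ (≤-<-trans (m/n≤m F j) F<n))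

  count-multiples-≡ : ∀ {n} → 1 ≤ F → F < n → count (λ m → does (j * m ≟ F)) n ≡ bit (does (j ∣? F))
  count-multiples-≡ {n} 1≤F F<n with j ∣? F
  ... | yes (divides q F≡q*j) =
    trans (count-cong n (λ m _ → does-⇔ (mk⇔ to from) (j * m ≟ F) (m ≟ q)))
          (count-≟ (≤-<-trans q≤F F<n))
    where
      to : ∀ {m} → j * m ≡ F → m ≡ q
      to {m} eq = *-cancelʳ-≡ m q j (trans (*-comm m j) (trans eq F≡q*j))
      from : ∀ {m} → m ≡ q → j * m ≡ F
      from {m} refl = trans (*-comm j m) (sym F≡q*j)
      q≤F : q ≤ F
      q≤F = subst (q ≤_) (sym F≡q*j) (m≤m*n q j)
  ... | no j∤F = count-false n (λ m _ → dec-false (j * m ≟ F) (λ eq → j∤F (divides m (trans (sym eq) (*-comm j m)))))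

count-between : ∀ j F {n} .{{_ : NonZero j}} → 1 ≤ F → F < n →
  count (λ m → does (between? j m F)) n + F / suc j + bit (does (j ∣? F)) ≡ F / j
count-between j F {n} 1≤F F<n = suc-injective (begin
  suc (c + F / suc j + b)                          ≡⟨ cong (_+ b) (+-suc c (F / suc j)) ⟨
  c + suc (F / suc j) + b                          ≡⟨ cong (λ x → c + x + b) (count-multiples-≤ (suc j) F F<n) ⟨
  c + count (λ m → does (suc j * m ≤? F)) n + b    ≡⟨ cong (_+ b) split-< ⟩
  #< + b                                           ≡⟨ cong (_+_ #<) (count-multiples-≡ j F 1≤F F<n) ⟨
  #< + count (λ m → does (j * m ≟ F)) n            ≡⟨ split-≤ ⟩
  count (λ m → does (j * m ≤? F)) n                ≡⟨ count-multiples-≤ j F F<n ⟩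
  suc (F / j)                                      ∎)
  where
    open ≡-Reasoning
    c  = count (λ m → does (between? j m F)) n
    b  = bit (does (j ∣? F))
    #< = count (λ m → does (j * m <? F)) n
    below-F : ∀ {m} → suc j * m ≤ F → j * m < F
    below-F {zero}  _  = subst (_< F) (sym (*-zeroʳ j)) 1≤F
    below-F {suc m} le = <-≤-trans (m<n+m (j * suc m) z<s) le
    split : ∀ m → j * m < F → BetweenMultiples j m F ⊎ suc j * m ≤ F
    split m lt with suc j * m ≤? F
    ... | yes le = inj₂ le
    ... | no  gt = inj₁ (lt , ≰⇒> gt)
    split-< = count-⊎ (λ m → between? j m F) (λ m → suc j * m ≤? F) (λ m → j * m <? F) n
      (λ m (_ , hi) → <⇒≱ hi)
      (λ m → mk⇔ [ proj₁ , below-F ]′ (split m))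
    split-≤ = count-⊎ (λ m → j * m <? F) (λ m → j * m ≟ F) (λ m → j * m ≤? F) n
      (λ m lt eq → <⇒≢ lt eq)
      (λ m → mk⇔ [ <⇒≤ , ≤-reflexive ]′ m≤n⇒m<n∨m≡n)

double : ℕ → ℕ
double zero    = zero
double (suc n) = suc (suc (double n))

double≡+ : ∀ n → double n ≡ n + n
double≡+ zero    = refl
double≡+ (suc n) = cong suc (trans (cong suc (double≡+ n)) (sym (+-suc n n)))

double≡2* : ∀ n → double n ≡ 2 * n
double≡2* n = trans (double≡+ n) (cong (_+_ n) (sym (+-identityʳ n)))

double-* : ∀ k m → double k * m ≡ k * m + k * m
double-* k m = trans (cong (_* m) (double≡+ k)) (*-distribʳ-+ m k k)

double-injective : ∀ {m n} → double m ≡ double n → m ≡ n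
double-injective {zero}  {zero}  _  = refl
double-injective {suc m} {suc n} eq = cong suc (double-injective (suc-injective (suc-injective eq)))

2∣double : ∀ n → 2 ∣ double n
2∣double n = divides n (trans (double≡2* n) (*-comm 2 n))

2∤1+double : ∀ n → ¬ 2 ∣ suc (double n)
2∤1+double n (divides q eq) = even≢odd q n (trans (*-comm 2 q) (trans (sym eq) (cong suc (double≡2* n))))

sign-double : ∀ n → (- + 1) ^ℤ double n ≡ 1ℤ
sign-double zero    = refl
sign-double (suc n) = cong (λ x → -1ℤ *ℤ (-1ℤ *ℤ x)) (sign-double n)

pos-+≡⇒ : ∀ {x y} {z : ℤ} → + (x + y) ≡ z → + x ≡ z -ℤ + y
pos-+≡⇒ {x} {y} eq = trans (cancel (+ x) (+ y)) (cong (_-ℤ + y) (trans (sym (ℤ.pos-+ x y)) eq))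
  where
    cancel : ∀ a b → a ≡ (a +ℤ b) -ℤ b
    cancel = solve-∀

between-double : ∀ {k m g} → BetweenMultiples k m g → BetweenMultiples (double k) m (g + k * m)
between-double {k} {m} {g} (km<g , g<m+km) =
  subst (_< g + k * m) (sym (double-* k m)) (+-monoˡ-< (k * m) km<g) ,
  subst (g + k * m <_) (trans (+-assoc m (k * m) (k * m)) (cong (_+_ m) (sym (double-* k m)))) (+-monoˡ-< (k * m) g<m+km)

between-halve : ∀ {k m F} → BetweenMultiples (double k) m F →
                BetweenMultiples k m (F ∸ k * m) × F ∸ k * m + k * m ≡ F
between-halve {k} {m} {F} (2km<F , F<m+2km) =
  ( +-cancelʳ-< (k * m) (k * m) (F ∸ k * m) (subst (k * m + k * m <_) (sym F∸km+km≡F) 2km<F′)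
  , +-cancelʳ-< (k * m) (F ∸ k * m) (m + k * m)
      (subst₂ _<_ (sym F∸km+km≡F) (sym (+-assoc m (k * m) (k * m))) (subst (F <_) (cong (_+_ m) (double-* k m)) F<m+2km)) )
  , F∸km+km≡F
  where
    2km<F′ = subst (_< F) (double-* k m) 2km<F
    F∸km+km≡F = m∸n+n≡m (≤-trans (m≤m+n (k * m) (k * m)) (<⇒≤ 2km<F′))

true≢false : true ≢ false
true≢false ()

dec-true⁻¹ : ∀ {A : Set} (a? : Dec A) → does a? ≡ true → A
dec-true⁻¹ (yes a) _ = a

dec-false⁻¹ : ∀ {A : Set} (a? : Dec A) → does a? ≡ false → ¬ A
dec-false⁻¹ (no ¬a) _ = ¬a

xor-true⇒≡not : ∀ {a b} → (a xor b) ≡ true → b ≡ not a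
xor-true⇒≡not {true}  {false} _ = refl
xor-true⇒≡not {false} {true}  _ = refl

least-true : ∀ (p : ℕ → Bool) n → p n ≡ true → Σ ℕ λ j → j ≤ n × p j ≡ true × (∀ i → i < j → p i ≡ false)
least-true p zero    p0≡t = 0 , z≤n , p0≡t , λ _ ()
least-true p (suc n) pn≡t with p 0 in p0
... | true  = 0 , z≤n , p0 , λ _ ()
... | false with least-true (λ i → p (suc i)) n pn≡t
...   | j , j≤n , pj , earlier = suc j , s≤s j≤n , pj , λ { zero _ → p0 ; (suc i) i<j → earlier i (≤-pred i<j) }

-- Genus, Frobenius number and multiplicity

gapsBelow≡count : ∀ S n → gapsBelow S n ≡ count (λ i → not (S i)) n
gapsBelow≡count S zero    = refl
gapsBelow≡count S (suc n) with S n
... | true  = gapsBelow≡count S n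
... | false = cong suc (gapsBelow≡count S n)

Paired : Subset → ℕ → Set
Paired S g = ∀ z → z < g → (S z xor S (z + g)) ≡ true

gaps-paired : ∀ {S g} → Paired S g → count (λ i → not (S i)) (g + g) ≡ g
gaps-paired {S} {g} paired = begin
  count p (g + g)                        ≡⟨ count-+ g g ⟩
  count p g + count (λ i → p (g + i)) g  ≡⟨ count-∨ g (λ i i<g → proj₁ (complementary i i<g)) ⟩
  count (λ i → p i ∨ p (g + i)) g        ≡⟨ count-true g (λ i i<g → proj₂ (complementary i i<g)) ⟩
  g                                      ∎
  where
    open ≡-Reasoning
    p = λ i → not (S i)
    not-xor : ∀ a b → (a xor b) ≡ true → not a ∧ not b ≡ false × not a ∨ not b ≡ true
    not-xor true  false _ = refl , refl
    not-xor false true  _ = refl , refl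
    complementary : ∀ i → i < g → p i ∧ p (g + i) ≡ false × p i ∨ p (g + i) ≡ true
    complementary i i<g = not-xor (S i) (S (g + i)) (subst (λ x → (S i xor S x) ≡ true) (+-comm i g) (paired i i<g))

∈-beyond-double-genus : ∀ {S g} → HasGenus S g → Paired S g → ∀ n → g + g ≤ n → S n ≡ true
∈-beyond-double-genus {S} {g} (N , ∈-beyond-N , gaps) paired n 2g≤n = ¬-not n∉S⇒⊥
  where
    open ≤-Reasoning
    p = λ i → not (S i)
    total : count p (N + suc n) ≡ g
    total = begin-equality
      count p (N + suc n)                          ≡⟨ count-+ N (suc n) ⟩
      count p N + count (λ i → p (N + i)) (suc n)  ≡⟨ cong₂ _+_ (trans (sym (gapsBelow≡count S N)) gaps)
                                                         (count-false (suc n) (λ i _ → cong not (∈-beyond-N (N + i) (m≤m+n N i)))) ⟩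
      g + 0                                        ≡⟨ +-identityʳ g ⟩
      g                                            ∎
    n∉S⇒⊥ : S n ≢ false
    n∉S⇒⊥ n∉S = 1+n≰n (begin
      suc g                  ≡⟨ cong suc (gaps-paired paired) ⟨
      suc (count p (g + g))  ≤⟨ s≤s (count-mono 2g≤n) ⟩
      suc (count p n)        ≡⟨ cong (λ b → bit (not b) + count p n) n∉S ⟨
      count p (suc n)        ≤⟨ count-mono (m≤n+m (suc n) N) ⟩
      count p (N + suc n)    ≡⟨ total ⟩
      g                      ∎)

frobenius-unique : ∀ {S T F F′} → (∀ n → S n ≡ T n) → HasFrobenius S F → HasFrobenius T F′ → F ≡ F′
frobenius-unique {S} {T} {F} {F′} S≗T (F∉S , beyond-F) (F′∉T , beyond-F′) = ≤-antisym (≮⇒≥ F′≮F) (≮⇒≥ F≮F′)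
  where
    F′≮F : ¬ F′ < F
    F′≮F F′<F = true≢false (trans (sym (beyond-F′ F F′<F)) (trans (sym (S≗T F)) F∉S))
    F≮F′ : ¬ F < F′
    F≮F′ F<F′ = true≢false (trans (sym (beyond-F F′ F<F′)) (trans (S≗T F′) F′∉T))

IsMultiplicity : Subset → ℕ → Set
IsMultiplicity S m = 1 ≤ m × S m ≡ true × (∀ n → 1 ≤ n → n < m → S n ≡ false)

multiplicity-unique : ∀ {S T m m′} → (∀ n → S n ≡ T n) → IsMultiplicity S m → IsMultiplicity T m′ → m ≡ m′
multiplicity-unique {S} {T} {m} {m′} S≗T (1≤m , m∈S , ∉S) (1≤m′ , m′∈T , ∉T) = ≤-antisym (≮⇒≥ m′≮m) (≮⇒≥ m≮m′)
  where
    m′≮m : ¬ m′ < m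
    m′≮m m′<m = true≢false (trans (sym m′∈T) (trans (sym (S≗T m′)) (∉S m′ 1≤m′ m′<m)))
    m≮m′ : ¬ m < m′
    m≮m′ m<m′ = true≢false (trans (sym m∈S) (trans (S≗T m) (∉T m 1≤m m<m′)))

-- The reflective semigroup of genus g and multiplicity m

reflective : ℕ → ℕ → Subset
reflective g m n =
  if does (n <? g) then does (m ∣? n)
  else if does (n <? g + g) then not (does (m ∣? (n ∸ g)))
  else true

module _ {g m : ℕ} where

  reflective-< : ∀ {n} → n < g → reflective g m n ≡ does (m ∣? n)
  reflective-< {n} n<g rewrite dec-true (n <? g) n<g = refl

  reflective-mid : ∀ {n} → g ≤ n → n < g + g → reflective g m n ≡ not (does (m ∣? (n ∸ g)))
  reflective-mid {n} g≤n n<2g rewrite dec-false (n <? g) (≤⇒≯ g≤n) | dec-true (n <? g + g) n<2g = refl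

  reflective-≥ : ∀ {n} → g + g ≤ n → reflective g m n ≡ true
  reflective-≥ {n} 2g≤n
    rewrite dec-false (n <? g) (≤⇒≯ (≤-trans (m≤m+n g g) 2g≤n)) | dec-false (n <? g + g) (≤⇒≯ 2g≤n) = refl

  reflective-∈ : ∀ {n} → g ≤ n → (n < g + g → ¬ m ∣ (n ∸ g)) → reflective g m n ≡ true
  reflective-∈ {n} g≤n m∤n∸g with n <? g + g
  ... | yes n<2g = trans (reflective-mid g≤n n<2g) (cong not (dec-false (m ∣? (n ∸ g)) (m∤n∸g n<2g)))
  ... | no  n≮2g = reflective-≥ (≮⇒≥ n≮2g)

  reflective-∈⁻ : ∀ {n} → reflective g m n ≡ true → (n < g × m ∣ n) ⊎ (g ≤ n × (n < g + g → ¬ m ∣ (n ∸ g)))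
  reflective-∈⁻ {n} n∈ with n <? g | n <? g + g
  ... | yes n<g | _        = inj₁ (n<g , dec-true⁻¹ (m ∣? n) (trans (sym (reflective-< n<g)) n∈))
  ... | no  n≮g | yes n<2g = inj₂ (≮⇒≥ n≮g , λ _ → dec-false⁻¹ (m ∣? (n ∸ g))
                                    (not-injective (trans (sym (reflective-mid (≮⇒≥ n≮g) n<2g)) n∈)))
  ... | no  n≮g | no  n≮2g = inj₂ (≮⇒≥ n≮g , λ n<2g → ⊥-elim (n≮2g n<2g))

  reflective-paired : Paired (reflective g m) g
  reflective-paired z z<g
    rewrite reflective-< z<g | reflective-mid (m≤n+m g z) (+-monoˡ-< g z<g) | m+n∸n≡m z g =
    xor-inverseʳ (does (m ∣? z))

  private
    multiple+shifted-∈ : ∀ {a b} → m ∣ a → g ≤ b → ¬ m ∣ (b ∸ g) → reflective g m (a + b) ≡ true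
    multiple+shifted-∈ {a} {b} m∣a g≤b m∤b∸g = reflective-∈ (≤-trans g≤b (m≤n+m b a))
      (λ _ m∣ → m∤b∸g (∣m+n∣m⇒∣n (subst (m ∣_) (+-∸-assoc a g≤b) m∣) m∣a))

    multiple-∈ : ¬ m ∣ g → ∀ {a} → m ∣ a → a < g + g → reflective g m a ≡ true
    multiple-∈ m∤g {a} m∣a a<2g with a <? g
    ... | yes a<g = trans (reflective-< a<g) (dec-true (m ∣? a) m∣a)
    ... | no  a≮g = reflective-∈ (≮⇒≥ a≮g)
      (λ _ m∣ → m∤g (∣m+n∣m⇒∣n (subst (m ∣_) (sym (m∸n+n≡m (≮⇒≥ a≮g))) m∣a) m∣))

  reflective-closed : ¬ m ∣ g → ∀ a b → reflective g m a ≡ true → reflective g m b ≡ true →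
                      reflective g m (a + b) ≡ true
  reflective-closed m∤g a b a∈ b∈ with a + b <? g + g
  ... | no  a+b≮2g = reflective-≥ (≮⇒≥ a+b≮2g)
  ... | yes a+b<2g with reflective-∈⁻ a∈ | reflective-∈⁻ b∈
  ...   | inj₁ (_ , m∣a) | inj₁ (_ , m∣b) = multiple-∈ m∤g (∣m∣n⇒∣m+n m∣a m∣b) a+b<2g
  ...   | inj₁ (_ , m∣a) | inj₂ (g≤b , b∈′) =
    multiple+shifted-∈ m∣a g≤b (b∈′ (≤-<-trans (m≤n+m b a) a+b<2g))
  ...   | inj₂ (g≤a , a∈′) | inj₁ (_ , m∣b) =
    subst (λ x → reflective g m x ≡ true) (+-comm b a)
          (multiple+shifted-∈ m∣b g≤a (a∈′ (≤-<-trans (m≤m+n a b) a+b<2g)))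
  ...   | inj₂ (g≤a , _) | inj₂ (g≤b , _) = ⊥-elim (<⇒≱ a+b<2g (+-mono-≤ g≤a g≤b))

  reflective-frobenius : ∀ {k} → BetweenMultiples k m g → HasFrobenius (reflective g m) (g + k * m)
  reflective-frobenius {k} (km<g , g<[1+k]m) = gap , beyond
    where
      gap : reflective g m (g + k * m) ≡ false
      gap = trans (reflective-mid (m≤m+n g (k * m)) (+-monoʳ-< g km<g))
                  (cong not (dec-true (m ∣? (g + k * m ∸ g)) (subst (m ∣_) (sym (m+n∸m≡n g (k * m))) (n∣m*n k))))
      beyond : ∀ n → g + k * m < n → reflective g m n ≡ true
      beyond n g+km<n = reflective-∈ g≤n λ n<2g → between⇒∤ {k}
          ( +-cancelˡ-< g (k * m) (n ∸ g) (subst (g + k * m <_) (sym (m+[n∸m]≡n g≤n)) g+km<n)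
          , <-trans (+-cancelʳ-< g (n ∸ g) g (subst (_< g + g) (sym (m∸n+n≡m g≤n)) n<2g)) g<[1+k]m )
        where g≤n = ≤-trans (m≤m+n g (k * m)) (<⇒≤ g+km<n)

  reflective-withFrobenius : ∀ {k} → BetweenMultiples k m g → ReflectiveWithFrobenius (g + k * m) (reflective g m)
  reflective-withFrobenius {k} between@(km<g , _) =
    (0∈ , reflective-closed (between⇒∤ {k} between) , g + g , λ _ → reflective-≥) ,
    (g , (g + g , (λ _ → reflective-≥) , trans (gapsBelow≡count _ (g + g)) (gaps-paired reflective-paired))
       , 1≤g , reflective-paired) ,
    reflective-frobenius {k} between
    where
      1≤g = ≤-<-trans z≤n km<g
      0∈ = trans (reflective-< 1≤g) (dec-true (m ∣? 0) (m ∣0))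

  reflective-multiplicity : ∀ {k} → BetweenMultiples k m g → m ≤ suc g → IsMultiplicity (reflective g m) m
  reflective-multiplicity {k} between@(km<g , g<[1+k]m) m≤1+g = 1≤m , m∈ , ∉-below-m
    where
      1≤g = ≤-<-trans z≤n km<g
      1≤m : 1 ≤ m
      1≤m = n≢0⇒n>0 (λ { refl → n≮0 (subst (g <_) (*-zeroʳ (suc k)) g<[1+k]m) })
      m∈ : reflective g m m ≡ true
      m∈ with m <? g
      ... | yes m<g = trans (reflective-< m<g) (dec-true (m ∣? m) ∣-refl)
      ... | no  m≮g = reflective-∈ (≮⇒≥ m≮g) λ _ m∣m∸g → between⇒∤ {k} between (subst (m ∣_)
              (≤-antisym (m∸n≡0⇒m≤n (∣∧<⇒≡0 m∣m∸g (∸-monoʳ-< {m} {g} {0} 1≤g (≮⇒≥ m≮g)))) (≮⇒≥ m≮g)) ∣-refl)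
      ∉-below-m : ∀ n → 1 ≤ n → n < m → reflective g m n ≡ false
      ∉-below-m n 1≤n n<m with n <? g
      ... | yes n<g = trans (reflective-< n<g) (dec-false (m ∣? n) (>⇒∤ ⦃ >-nonZero 1≤n ⦄ n<m))
      ... | no  n≮g = trans (reflective-mid (≮⇒≥ n≮g) (≤-<-trans n≤g (m<m+n g 1≤g)))
                            (cong not (dec-true (m ∣? (n ∸ g)) (subst (m ∣_) (sym (m≤n⇒m∸n≡0 n≤g)) (m ∣0))))
        where n≤g = ≤-pred (<-≤-trans n<m m≤1+g)

module Classification {S : Subset} {g m : ℕ}
  (0∈S : S 0 ≡ true) (closed : ∀ a b → S a ≡ true → S b ≡ true → S (a + b) ≡ true)
  (paired : Paired S g) (∈-beyond-2g : ∀ n → g + g ≤ n → S n ≡ true)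
  (multiplicity : IsMultiplicity S m) where

  private
    instance
      m≢0 : NonZero m
      m≢0 = >-nonZero (proj₁ multiplicity)

    m∈S : S m ≡ true
    m∈S = proj₁ (proj₂ multiplicity)

    ∉-below-m : ∀ n → 1 ≤ n → n < m → S n ≡ false
    ∉-below-m = proj₂ (proj₂ multiplicity)

  shifted : ∀ {z} → z < g → S (z + g) ≡ not (S z)
  shifted {z} z<g = xor-true⇒≡not (paired z z<g)

  multiple-∈ : ∀ {n} → m ∣ n → S n ≡ true
  multiple-∈ (divides q refl) = q*m∈ q
    where
      q*m∈ : ∀ q → S (q * m) ≡ true
      q*m∈ zero    = 0∈S
      q*m∈ (suc q) = closed m (q * m) m∈S (q*m∈ q)

  -- If r = n % m ≠ 0 then r ∉ S, so r + g ∈ S and n + g = (n / m) * m + (r + g) ∈ S, contradicting n ∈ S.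
  ∈-below-g⇒∣ : ∀ {n} → n < g → S n ≡ true → m ∣ n
  ∈-below-g⇒∣ {n} n<g n∈S with n % m ≟ 0
  ... | yes r≡0 = m%n≡0⇒n∣m n m r≡0
  ... | no  r≢0 = ⊥-elim (true≢false (trans (sym n+g∈S) n+g∉S))
    where
      r+g∈S : S (n % m + g) ≡ true
      r+g∈S = trans (shifted (≤-<-trans (m%n≤m n m) n<g)) (cong not (∉-below-m (n % m) (n≢0⇒n>0 r≢0) (m%n<n n m)))
      n+g∈S : S (n + g) ≡ true
      n+g∈S = subst (λ x → S x ≡ true)
        (trans (sym (+-assoc (n / m * m) (n % m) g))
               (cong (_+ g) (trans (+-comm (n / m * m) (n % m)) (sym (m≡m%n+[m/n]*n n m)))))
        (closed _ _ (multiple-∈ (n∣m*n (n / m))) r+g∈S)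
      n+g∉S : S (n + g) ≡ false
      n+g∉S = trans (shifted n<g) (cong not n∈S)

  below-g : ∀ {n} → n < g → S n ≡ does (m ∣? n)
  below-g {n} n<g with m ∣? n
  ... | yes m∣n = multiple-∈ m∣n
  ... | no  m∤n = ¬-not (λ n∈S → m∤n (∈-below-g⇒∣ n<g n∈S))

  S≗reflective : ∀ n → S n ≡ reflective g m n
  S≗reflective n with n <? g | n <? g + g
  ... | yes n<g | _        = trans (below-g n<g) (sym (reflective-< {g} {m} n<g))
  ... | no  n≮g | yes n<2g = begin
    S n                        ≡⟨ cong S (m∸n+n≡m g≤n) ⟨
    S (n ∸ g + g)              ≡⟨ shifted n∸g<g ⟩
    not (S (n ∸ g))            ≡⟨ cong not (below-g n∸g<g) ⟩
    not (does (m ∣? (n ∸ g)))  ≡⟨ reflective-mid {g} {m} g≤n n<2g ⟨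
    reflective g m n           ∎
    where
      open ≡-Reasoning
      g≤n = ≮⇒≥ n≮g
      n∸g<g = +-cancelʳ-< g (n ∸ g) g (subst (_< g + g) (sym (m∸n+n≡m g≤n)) n<2g)
  ... | no  _   | no  n≮2g = trans (∈-beyond-2g n (≮⇒≥ n≮2g)) (sym (reflective-≥ {g} {m} (≮⇒≥ n≮2g)))

reflective-classification : ∀ {F S} → ReflectiveWithFrobenius F S →
  Σ ℕ λ k → Σ ℕ λ m → (BetweenMultiples (double k) m F × m ≤ suc F) × (∀ n → reflective (F ∸ k * m) m n ≡ S n)
reflective-classification {F} {S} ((0∈S , closed , _) , (g , genus , 1≤g , paired) , F∉S , beyond-F)
  with least-true (λ i → S (suc i)) F (beyond-F (suc F) ≤-refl)
... | j , j≤F , m∈S , earlier = k , m , (admissible , s≤s j≤F) , decode≗S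
  where
    m = suc j
    multiplicity : IsMultiplicity S m
    multiplicity = s≤s z≤n , m∈S , λ { (suc i) _ (s≤s i<j) → earlier i i<j }
    open Classification 0∈S closed paired (∈-beyond-double-genus genus paired) multiplicity
    m∤g : ¬ m ∣ g
    m∤g m∣g = true≢false (trans (sym (multiple-∈ m∣g)) (trans (xor-true⇒≡not (paired 0 1≤g)) (cong not 0∈S)))
    k = g / m
    between = ∤⇒between m∤g
    F≡g+km : F ≡ g + k * m
    F≡g+km = frobenius-unique S≗reflective (F∉S , beyond-F) (reflective-frobenius {g} {m} {k} between)
    admissible = subst (BetweenMultiples (double k) m) (sym F≡g+km) (between-double {k} {m} {g} between)
    decode≗S : ∀ n → reflective (F ∸ k * m) m n ≡ S n
    decode≗S n = trans (cong (λ h → reflective (h ∸ k * m) m n) F≡g+km)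
                       (trans (cong (λ h → reflective h m n) (m+n∸n≡m g (k * m))) (sym (S≗reflective n)))

-- Reflective semigroups with Frobenius number F

module _ (F : ℕ) where

  Admissible : ℕ × ℕ → Set
  Admissible (k , m) = BetweenMultiples (double k) m F

  admissible? : Decidable Admissible
  admissible? (k , m) = between? (double k) m F

  -- The multiplicity of a semigroup with Frobenius number F is at most F + 1, whence the range of m.
  codes : ℕ → List (ℕ × ℕ)
  codes K = filter admissible? (cartesianProduct (downFrom K) (downFrom (2 + F)))

  decode : ℕ × ℕ → Subset
  decode (k , m) = reflective (F ∸ k * m) m

  admissible⇒k≤F : ∀ {k m} → Admissible (k , m) → k ≤ F
  admissible⇒k≤F {k} {zero}  (_ , F<0) = ⊥-elim (n≮0 (subst (F <_) (*-zeroʳ (suc (double k))) F<0))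
  admissible⇒k≤F {k} {suc m} (2km<F , _) =
    ≤-trans (≤-trans (subst (k ≤_) (sym (double≡+ k)) (m≤m+n k k)) (m≤m*n (double k) (suc m))) (<⇒≤ 2km<F)

  admissible-multiplicity : ∀ {k m} → Admissible (k , m) → m ≤ suc F → IsMultiplicity (decode (k , m)) m
  admissible-multiplicity {k} {m} admissible m≤1+F =
    reflective-multiplicity {F ∸ k * m} {m} {k} between (m≤1+g k between)
    where
      between = proj₁ (between-halve {k} {m} admissible)
      m≤1+g : ∀ k → BetweenMultiples k m (F ∸ k * m) → m ≤ suc (F ∸ k * m)
      m≤1+g zero    _          = subst (λ g → m ≤ suc (F ∸ g)) (sym (*-zeroˡ m)) m≤1+F
      m≤1+g (suc k) (km<g , _) = m≤n⇒m≤1+n (<⇒≤ (≤-<-trans (m≤m+n m (k * m)) km<g))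

  codes-unique : ∀ K → Unique (codes K)
  codes-unique K = filter⁺ admissible? (cartesianProduct⁺ (downFrom⁺ K) (downFrom⁺ (2 + F)))

  codes⁻ : ∀ {K k m} → (k , m) ∈ codes K → Admissible (k , m) × m ≤ suc F
  codes⁻ {K} x∈ with ∈-filter⁻ admissible? x∈
  ... | x∈product , admissible =
    admissible , ≤-pred (∈-downFrom⁻ (proj₂ (∈-cartesianProduct⁻ (downFrom K) (downFrom (2 + F)) x∈product)))

  codes-sound : ∀ {K x} → x ∈ codes K → ReflectiveWithFrobenius F (decode x)
  codes-sound {K} {k , m} x∈ with between-halve {k} {m} (proj₁ (codes⁻ {K} x∈))
  ... | between , g+km≡F = subst (λ h → ReflectiveWithFrobenius h (decode (k , m))) g+km≡F
                                 (reflective-withFrobenius {F ∸ k * m} {m} {k} between)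

  codes-injective : ∀ {K x y} → x ∈ codes K → y ∈ codes K → (∀ n → decode x n ≡ decode y n) → x ≡ y
  codes-injective {K} {k , m} {k′ , m′} x∈ y∈ x≗y = cong₂ _,_ k≡k′ m≡m′
    where
      adm  = codes⁻ {K} x∈
      adm′ = codes⁻ {K} y∈
      m≡m′ = multiplicity-unique x≗y (admissible-multiplicity {k} {m} (proj₁ adm) (proj₂ adm))
                                     (admissible-multiplicity {k′} {m′} (proj₁ adm′) (proj₂ adm′))
      k≡k′ = double-injective (between-unique {double k} {double k′}
                                (proj₁ adm) (subst (λ m → Admissible (k′ , m)) (sym m≡m′) (proj₁ adm′)))

  codes-complete : ∀ S → ReflectiveWithFrobenius F S →
                   Σ (ℕ × ℕ) λ x → x ∈ codes (suc F) × (∀ n → decode x n ≡ S n)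
  codes-complete S S-refl with reflective-classification S-refl
  ... | k , m , (admissible , m≤1+F) , decode≗S = (k , m) , x∈codes , decode≗S
    where
      x∈codes = ∈-filter⁺ admissible?
        (∈-cartesianProduct⁺ (∈-downFrom⁺ (s≤s (admissible⇒k≤F admissible))) (∈-downFrom⁺ (s≤s m≤1+F)))
        admissible

  hasCount-codes : HasCount (ReflectiveWithFrobenius F) (length (codes (suc F)))
  hasCount-codes = hasCount-fromList decode (codes (suc F)) (codes-unique (suc F))
    (codes-sound {suc F}) (codes-injective {suc F}) codes-complete

  length-codes-suc : ∀ K → length (codes (suc K)) ≡ count (λ m → does (admissible? (K , m))) (2 + F) + length (codes K)
  length-codes-suc K = begin
    length (filter admissible? (row ++ cartesianProduct (downFrom K) ms))
      ≡⟨ cong length (filter-++ admissible? row _) ⟩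
    length (filter admissible? row ++ codes K)
      ≡⟨ length-++ (filter admissible? row) ⟩
    length (filter admissible? row) + length (codes K)
      ≡⟨ cong (_+ length (codes K)) (trans (length-filter-map admissible? (K ,_) ms)
                                            (length-filter-downFrom (λ m → admissible? (K , m)) (2 + F))) ⟩
    count (λ m → does (admissible? (K , m))) (2 + F) + length (codes K) ∎
    where
      open ≡-Reasoning
      ms  = downFrom (2 + F)
      row = map (K ,_) ms

  admissible-count-zero : 1 ≤ F → count (λ m → does (admissible? (0 , m))) (2 + F) ≡ 1
  admissible-count-zero 1≤F =
    trans (count-cong (2 + F) (λ m m<2+F → does-⇔ (mk⇔ (to m<2+F) from) (admissible? (0 , m)) (m ≟ suc F)))
          (count-≟ {suc F} ≤-refl)
    where
      to : ∀ {m} → m < 2 + F → Admissible (0 , m) → m ≡ suc F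
      to {m} m<2+F (_ , F<m) = ≤-antisym (≤-pred m<2+F) (subst (F <_) (*-identityˡ m) F<m)
      from : ∀ {m} → m ≡ suc F → Admissible (0 , m)
      from refl = 1≤F , subst (F <_) (sym (*-identityˡ (suc F))) ≤-refl

  admissible-count-suc : 1 ≤ F → ∀ k →
    count (λ m → does (admissible? (suc k , m))) (2 + F) + F / suc (double (suc k)) + bit (does (double (suc k) ∣? F))
      ≡ F / double (suc k)
  admissible-count-suc 1≤F k = count-between (double (suc k)) F 1≤F (m<n⇒m<1+n (n<1+n F))

  evenDivisor? : Decidable (λ d → 2 ∣ d × d ∣ F)
  evenDivisor? d = (2 ∣? d) ×-dec (d ∣? F)

  evenDivisors : ℕ → ℕ
  evenDivisors n = count (λ i → does (evenDivisor? (suc i))) n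

  τe≡evenDivisors : τe F ≡ evenDivisors F
  τe≡evenDivisors = trans (length-filter-map evenDivisor? suc (upTo F)) (length-filter-upTo (λ i → evenDivisor? (suc i)) F)

  evenDivisors-double : 1 ≤ F → evenDivisors (double F) ≡ evenDivisors F
  evenDivisors-double 1≤F = begin
    evenDivisors (double F)                                           ≡⟨ cong evenDivisors (double≡+ F) ⟩
    evenDivisors (F + F)                                              ≡⟨ count-+ F F ⟩
    evenDivisors F + count (λ i → does (evenDivisor? (suc (F + i)))) F ≡⟨ cong (_+_ (evenDivisors F)) (count-false F too-large) ⟩
    evenDivisors F + 0                                                ≡⟨ +-identityʳ _ ⟩
    evenDivisors F                                                    ∎
    where
      open ≡-Reasoning
      too-large : ∀ i → i < F → does (evenDivisor? (suc (F + i))) ≡ false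
      too-large i _ = dec-false (evenDivisor? (suc (F + i)))
        (λ (_ , d∣F) → <⇒≱ (s≤s (m≤m+n F i)) (∣⇒≤ ⦃ >-nonZero 1≤F ⦄ d∣F))

  evenDivisors-step : ∀ K → evenDivisors (double (suc K)) ≡ bit (does (double (suc K) ∣? F)) + evenDivisors (double K)
  evenDivisors-step K = cong₂ _+_ (cong bit even) (cong (λ b → bit b + evenDivisors (double K)) odd)
    where
      even : does (evenDivisor? (double (suc K))) ≡ does (double (suc K) ∣? F)
      even = cong (_∧ does (double (suc K) ∣? F)) (dec-true (2 ∣? double (suc K)) (2∣double (suc K)))
      odd : does (evenDivisor? (suc (double K))) ≡ false
      odd = cong (_∧ does (suc (double K) ∣? F)) (dec-false (2 ∣? suc (double K)) (2∤1+double K))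

  altSum-suc : ∀ {n} → F ≤ n → altSum F (suc n) ≡ altSum F n
  altSum-suc {zero}  _   = refl
  altSum-suc {suc j} F≤n rewrite m<n⇒m/n≡0 {F} {suc (suc j)} (s≤s F≤n) =
    trans (cong (altSum F (suc j) +ℤ_) (ℤ.*-zeroʳ ((- + 1) ^ℤ suc (suc j)))) (ℤ.+-identityʳ _)

  altSum-beyond : ∀ d → altSum F (d + F) ≡ altSum F F
  altSum-beyond zero    = refl
  altSum-beyond (suc d) = trans (altSum-suc (m≤n+m F d)) (altSum-beyond d)

  altSum-step : ∀ K → altSum F (suc (double (suc K)))
                    ≡ altSum F (suc (double K)) +ℤ (+ (F / double (suc K)) -ℤ + (F / suc (double (suc K))))
  altSum-step K = begin
    (A +ℤ (- + 1) ^ℤ double (suc K) *ℤ + a) +ℤ (- + 1) ^ℤ suc (double (suc K)) *ℤ + b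
      ≡⟨ cong₂ (λ s t → (A +ℤ s *ℤ + a) +ℤ t *ℤ + b) (sign-double (suc K)) (cong (-1ℤ *ℤ_) (sign-double (suc K))) ⟩
    (A +ℤ 1ℤ *ℤ + a) +ℤ -1ℤ *ℤ + b
      ≡⟨ regroup A (+ a) (+ b) ⟩
    A +ℤ (+ a -ℤ + b) ∎
    where
      open ≡-Reasoning
      A = altSum F (suc (double K))
      a = F / double (suc K)
      b = F / suc (double (suc K))
      regroup : ∀ A a b → (A +ℤ 1ℤ *ℤ a) +ℤ -1ℤ *ℤ b ≡ A +ℤ (a -ℤ b)
      regroup = solve-∀

  length-codes≡altSum : 1 ≤ F → ∀ K →
    + (length (codes (suc K)) + evenDivisors (double K)) ≡ 1ℤ +ℤ altSum F (suc (double K))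
  length-codes≡altSum 1≤F zero =
    cong (λ c → + (c + 0)) (trans (length-codes-suc 0) (cong (_+ 0) (admissible-count-zero 1≤F)))
  length-codes≡altSum 1≤F (suc K) = begin
    + (length (codes (2 + K)) + evenDivisors (double (suc K)))
      ≡⟨ cong +_ (cong₂ _+_ (length-codes-suc (suc K)) (evenDivisors-step K)) ⟩
    + ((c + L) + (b + E))
      ≡⟨ cong +_ (interchange c L b E) ⟩
    + ((c + b) + (L + E))
      ≡⟨ ℤ.pos-+ (c + b) (L + E) ⟩
    + (c + b) +ℤ + (L + E)
      ≡⟨ cong₂ _+ℤ_ row-count (length-codes≡altSum 1≤F K) ⟩
    (+ (F / e) -ℤ + (F / suc e)) +ℤ (1ℤ +ℤ altSum F (suc (double K)))
      ≡⟨ regroup (+ (F / e) -ℤ + (F / suc e)) (altSum F (suc (double K))) ⟩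
    1ℤ +ℤ (altSum F (suc (double K)) +ℤ (+ (F / e) -ℤ + (F / suc e)))
      ≡⟨ cong (1ℤ +ℤ_) (altSum-step K) ⟨
    1ℤ +ℤ altSum F (suc (double (suc K))) ∎
    where
      open ≡-Reasoning
      e = double (suc K)
      c = count (λ m → does (admissible? (suc K , m))) (2 + F)
      b = bit (does (e ∣? F))
      L = length (codes (suc K))
      E = evenDivisors (double K)
      row-count : + (c + b) ≡ + (F / e) -ℤ + (F / suc e)
      row-count = pos-+≡⇒ (cong +_ (trans (xy∙z≈xz∙y c b (F / suc e)) (admissible-count-suc 1≤F K)))
      regroup : ∀ d a → d +ℤ (1ℤ +ℤ a) ≡ 1ℤ +ℤ (a +ℤ d)
      regroup = solve-∀

  length-codes≡nF-formula : 1 ≤ F → + length (codes (suc F)) ≡ nF-formula F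
  length-codes≡nF-formula 1≤F = begin
    + N                                          ≡⟨ pos-+≡⇒ (trans (cong (λ t → + (N + t)) τe≡) (length-codes≡altSum 1≤F F)) ⟩
    (1ℤ +ℤ altSum F (suc (double F))) -ℤ + τe F  ≡⟨ cong (λ a → (1ℤ +ℤ a) -ℤ + τe F) altSum≡ ⟩
    (1ℤ +ℤ altSum F F) -ℤ + τe F                 ≡⟨ regroup (altSum F F) (+ τe F) ⟩
    nF-formula F                                 ∎
    where
      open ≡-Reasoning
      N = length (codes (suc F))
      τe≡ = trans τe≡evenDivisors (sym (evenDivisors-double 1≤F))
      altSum≡ = trans (cong (λ n → altSum F (suc n)) (double≡+ F)) (altSum-beyond (suc F))
      regroup : ∀ a t → (1ℤ +ℤ a) -ℤ t ≡ (1ℤ -ℤ t) +ℤ a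
      regroup = solve-∀

corollary5p10 : (F : ℕ) → 1 ≤ F →
    Σ ℕ (λ N → HasCount (ReflectiveWithFrobenius F) N × (+ N ≡ nF-formula F))
corollary5p10 F 1≤F = length (codes F (suc F)) , hasCount-codes F , length-codes≡nF-formula F 1≤F
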